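{- Let $G(x,y,p)$ be the generating function of monomer–dimer semi-pyramids defined in the context, and let \[ G'(x,y,p):=(pxy)^{ -1}\Bigl([\,a_0=pxy,\ a_i=p^{i}xy^{2}\ (i\ge1)\,]-1\Bigr). \] Then $G(x,y,p)=G'(x,y,p)$ as formal power series.
   Context: **Heaps.** A heap (Viennot) over a set with a symmetric reflexive concurrency relation is a finite poset with a labelling such that concurrent pieces are comparable and covering pieces are concurrent, up to isomorphism. Here the pieces are monomers, the one-point segment $[1,1]$ (a monomer can only sit at abscissa $1$), and dimers, segments $[c,c+1]$ with $c\ge1$. Two pieces are concurrent iff they intersect. The left abscissa of $[c,d]$ is $c$. **Generating function.** For a heap $H$ with $N(d)$ dimers and $N(m)$ monomers, let $v(H)=x^{N(d)+N(m)}y^{2N(d)+N(m)}p^{\sum(\text{left abscissae of pieces})}$. Define $G(x,y,p)=\sum_H v(H)$. The sum is over all such heaps with a unique maximal piece whose left abscissa is $1$, together with the empty heap, which contributes $1$. **Continued fractions.** $[a_0,a_1,a_2,\dots]$ denotes $\cfrac{1}{1-\cfrac{a_0}{1-\cfrac{a_1}{1-\cdots}}}$. -}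

module Defs where

open import Data.Nat using (ℕ; zero; suc; _+_; _*_; _∸_; _≡ᵇ_; _≤ᵇ_)
open import Data.Bool using (Bool; true; false; T; _∧_; if_then_else_)
open import Data.Fin using (Fin; zero; suc)
open import Data.Fin.Permutation using (Permutation′; _⟨$⟩ʳ_)
open import Data.Product using (Σ; _×_; ∃; _,_)
open import Data.Sum using (_⊎_)
open import Relation.Binary.PropositionalEquality using (_≡_; _≢_)
open import Relation.Nullary using (¬_)

-- Pieces: the monomer [1,1] and dimers [c,c+1] with c ≥ 1.
-- `dimer k` denotes the segment [k+1, k+2] (so c = k+1 ≥ 1).

data Piece : Set where
  monomer : Piece
  dimer   : ℕ → Piece

leftAbs : Piece → ℕ
leftAbs monomer   = 1
leftAbs (dimer k) = suc k

rightAbs : Piece → ℕ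
rightAbs monomer   = 1
rightAbs (dimer k) = suc (suc k)

size : Piece → ℕ
size monomer   = 1
size (dimer k) = 2

Concurrent : Piece → Piece → Set
Concurrent P Q = T ((leftAbs P ≤ᵇ rightAbs Q) ∧ (leftAbs Q ≤ᵇ rightAbs P))

record Heap (n : ℕ) : Set where
  field
    label : Fin n → Piece
    leq   : Fin n → Fin n → Bool

  _≼_ : Fin n → Fin n → Set
  i ≼ j = T (leq i j)

  _≺_ : Fin n → Fin n → Set
  i ≺ j = (i ≼ j) × (i ≢ j)

  _⋖_ : Fin n → Fin n → Set
  i ⋖ j = (i ≺ j) × (∀ k → ¬ ((i ≺ k) × (k ≺ j)))

  field
    ≼-refl    : ∀ i → i ≼ i
    ≼-antisym : ∀ i j → i ≼ j → j ≼ i → i ≡ j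
    ≼-trans   : ∀ i j k → i ≼ j → j ≼ k → i ≼ k
    concurrent⇒comparable : ∀ i j → Concurrent (label i) (label j) → (i ≼ j) ⊎ (j ≼ i)
    cover⇒concurrent : ∀ i j → i ⋖ j → Concurrent (label i) (label j)

open Heap public

Iso : ∀ {n} → Heap n → Heap n → Set
Iso {n} H K = Σ (Permutation′ n) λ σ →
  (∀ i → label K (σ ⟨$⟩ʳ i) ≡ label H i) ×
  (∀ i j → leq K (σ ⟨$⟩ʳ i) (σ ⟨$⟩ʳ j) ≡ leq H i j)

Maximal : ∀ {n} → Heap n → Fin n → Set
Maximal H m = ∀ j → _≼_ H m j → j ≡ m

SemiPyramid : ∀ {n} → Heap n → Set
SemiPyramid {n} H = Σ (Fin n) λ m →
  Maximal H m × (∀ j → Maximal H j → j ≡ m) × (leftAbs (label H m) ≡ 1)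

-- heaps summed over in G: semi-pyramids, together with the empty heap
Admissible : ∀ {n} → Heap n → Set
Admissible {n} H = (n ≡ 0) ⊎ SemiPyramid H

sumFin : ∀ n → (Fin n → ℕ) → ℕ
sumFin zero    f = 0
sumFin (suc n) f = f zero + sumFin n (λ i → f (suc i))

yWeight : ∀ {n} → Heap n → ℕ
yWeight {n} H = sumFin n (λ i → size (label H i))

pWeight : ∀ {n} → Heap n → ℕ
pWeight {n} H = sumFin n (λ i → leftAbs (label H i))

-- `N` is the number of isomorphism classes of admissible heaps with
-- n pieces (exponent of x), y-exponent b and p-exponent c; i.e. the
-- coefficient of x^n y^b p^c in G.  Witnessed by an enumeration of
-- representatives, one per isomorphism class.
IsoClassCount : ℕ → ℕ → ℕ → ℕ → Set
IsoClassCount n b c N = Σ (Fin N → Heap n) λ e →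
  (∀ i → Admissible (e i) × (yWeight (e i) ≡ b) × (pWeight (e i) ≡ c)) ×
  (∀ i j → Iso (e i) (e j) → i ≡ j) ×
  (∀ (H : Heap n) → Admissible H → yWeight H ≡ b → pWeight H ≡ c →
     ∃ λ i → Iso H (e i))

-- Formal power series in x, y, p with ℕ coefficients:
-- f a b c = coefficient of x^a y^b p^c.

Series : Set
Series = ℕ → ℕ → ℕ → ℕ

sumTo : ℕ → (ℕ → ℕ) → ℕ
sumTo zero    f = f 0
sumTo (suc n) f = sumTo n f + f (suc n)

one : Series
one a b c = if (a ≡ᵇ 0) ∧ (b ≡ᵇ 0) ∧ (c ≡ᵇ 0) then 1 else 0

monomial : ℕ → ℕ → ℕ → Series
monomial e f g a b c = if (a ≡ᵇ e) ∧ (b ≡ᵇ f) ∧ (c ≡ᵇ g) then 1 else 0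

_⊛_ : Series → Series → Series
(f ⊛ g) a b c =
  sumTo a λ i → sumTo b λ j → sumTo c λ k → f i j k * g (a ∸ i) (b ∸ j) (c ∸ k)

pow : Series → ℕ → Series
pow g zero    = one
pow g (suc k) = g ⊛ pow g k

-- 1/(1 - g) for a series g divisible by x: coefficient of x^a only
-- involves g^k for k ≤ a.
geom : Series → Series
geom g a b c = sumTo a λ k → pow g k a b c

cfCoeff : ℕ → Series
cfCoeff zero    = monomial 1 1 1
cfCoeff (suc i) = monomial 1 2 (suc i)

cfTrunc : ℕ → ℕ → Series
cfTrunc zero    i = one
cfTrunc (suc d) i = geom (cfCoeff i ⊛ cfTrunc d (suc i))

-- F = [a_0, a_1, ...] : since every a_i is divisible by x, the depth-(a+1)
-- truncation already has the correct coefficient of x^a (x-adic limit).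
F : Series
F a b c = cfTrunc (suc a) 0 a b c

-- A piece is encoded by a letter: 0 is the monomer and k + 1 the dimer [k+1, k+2], so two pieces are
-- concurrent iff their letters differ by at most one.  Reading a heap from the top, always removing a
-- maximal piece with the largest letter, lists its pieces as a normal word, in which every letter is at
-- most one more than the previous one.  A normal word is determined by its heap (the first position an
-- isomorphism moves would carry a larger letter in each word than in the other), and its heap is a
-- semi-pyramid iff its first letter is at most 1.  On the series side, 1/(1 - a_i/(1 - a_{i+1}/(1 - ...)))
-- expands into sequences of blocks i u with u a word of the next level, and these are exactly the normal
-- words that start with i and have no letter below i.  As a_i is the weight of the letter i, the
-- coefficient of x^(a+1) y^(b+1) p^(c+1) in F counts the normal words 0 r with r of weight (a, b, c),
-- that is, the semi-pyramids of that weight up to isomorphism.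
module Submission where

open import Defs
open import Data.Bool as Bool using (Bool; true; false; T; _∧_; _∨_)
open import Data.Bool.Properties using (T-∧; T-≡; ⇔→≡; ∨-zeroʳ)
open import Data.Empty using (⊥; ⊥-elim)
open import Data.Fin as Fin using (Fin; zero; suc; toℕ; fromℕ<)
open import Data.Fin.Induction as Fin using (spo-wellFounded; spo-noetherian)
open import Data.Fin.Permutation as Perm using (Permutation′; _⟨$⟩ʳ_; _⟨$⟩ˡ_; inverseˡ; inverseʳ)
open import Data.Fin.Properties as Fin using (+↔⊎; *↔×; 0↔⊥; 1↔⊤)
open import Data.List using (List; []; _∷_; _++_; [_]; length; map; tabulate)
open import Data.List.Properties
  using (++-cancelˡ; ++-conicalˡ; length-++; length-tabulate; map-++; ∷-injective; ∷-injectiveʳ)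
open import Data.List.Relation.Unary.All as All using (All; []; _∷_)
open import Data.List.Relation.Unary.All.Properties as All using ()
open import Data.List.Relation.Unary.Linked as Linked using (Linked; []; [-]; _∷_)
open import Data.Maybe as Maybe using (Maybe; just; nothing)
open import Data.Maybe.Properties using (just-injective)
open import Data.Nat using (ℕ; zero; suc; _+_; _*_; _∸_; _≤_; _<_; z≤n; s≤s; _≡ᵇ_; _≤ᵇ_; _≤?_; _<?_)
open import Data.Nat.Induction using (<-wellFounded)
open import Data.Nat.ListAction using (sum)
open import Data.Nat.ListAction.Properties using (sum-++)
open import Data.Nat.Properties
  using ( _≟_; ≤-refl; ≤-reflexive; ≤-trans; ≤-antisym; ≤-pred; <-trans; <-irrefl; <-asym; <-cmp; <⇒≤; ≤∧≢⇒<
        ; ≤⇒≯; ≰⇒>; ≮⇒≥; n≤1+n; n<1+n; m≤n⇒m≤1+n; m≤n⇒m<n∨m≡n; n≤0⇒n≡0; m≤m+n; m≤n+m; +-mono-≤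
        ; +-identityʳ; m+[n∸m]≡n; m+n∸m≡n; suc-injective; ≡ᵇ⇒≡; ≡⇒≡ᵇ; ≤ᵇ⇒≤; ≤⇒≤ᵇ
        ; <-isStrictPartialOrder; +-0-commutativeMonoid )
open import Algebra.Properties.CommutativeMonoid.Sum +-0-commutativeMonoid using (sum-permute) renaming (sum to ∑)
open import Data.Product using (∃; ∃₂; _×_; _,_; proj₁; proj₂)
open import Data.Product.Function.NonDependent.Propositional using (_×-⇔_)
open import Data.Sum as Sum using (_⊎_; inj₁; inj₂; [_,_]′)
open import Data.Unit using (⊤; tt)
open import Function using (_∘_; flip; _↔_; _⇔_; mk⇔; Inverse; Equivalence; Injection)
open import Function.Definitions using (Injective)
import Function.Properties.Equivalence as ⇔
open import Function.Properties.Inverse using (↔⇒↣)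
open import Induction.WellFounded using (WellFounded; Acc; acc)
open import Relation.Binary using (Rel; IsStrictPartialOrder; Decidable; tri<; tri≈; tri>)
import Relation.Binary.Construct.Flip.EqAndOrd as Flip
import Relation.Binary.Construct.On as On
open import Relation.Binary.PropositionalEquality
  using (_≡_; _≢_; refl; sym; trans; cong; cong₂; subst; subst₂; isEquivalence; module ≡-Reasoning)
open import Relation.Nullary using (¬_; Dec; yes; no; map′; ¬?; _×-dec_; _→-dec_)
open import Relation.Nullary.Decidable using (True; isYes; toWitness; fromWitness; T?)
open import Relation.Unary using (_∪_; _∩_)

private
  variable
    A I J : Set
    P Q : A → Set

-- Enumerations

record Enumeration {A : Set} (I : Set) (P : A → Set) : Set where
  field
    element   : I → A
    injective : Injective _≡_ _≡_ element
    sound     : ∀ i → P (element i)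
    complete  : ∀ {x} → P x → ∃ λ i → element i ≡ x

open Enumeration

enum-⇔ : (∀ {x} → P x ⇔ Q x) → Enumeration I P → Enumeration I Q
enum-⇔ P⇔Q E = record
  { element   = element E
  ; injective = injective E
  ; sound     = Equivalence.to P⇔Q ∘ sound E
  ; complete  = complete E ∘ Equivalence.from P⇔Q
  }

enum-reindex : I ↔ J → Enumeration J P → Enumeration I P
enum-reindex ι E = record
  { element   = element E ∘ to
  ; injective = λ {i} {i′} eq → trans (sym (strictlyInverseʳ i)) (trans (cong from (injective E eq)) (strictlyInverseʳ i′))
  ; sound     = sound E ∘ to
  ; complete  = λ px → let (j , eq) = complete E px in from j , trans (cong (element E) (strictlyInverseˡ j)) eq
  }
  where open Inverse ι

enum-⊤ : (x₀ : A) → Enumeration ⊤ (_≡ x₀)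
enum-⊤ x₀ = record
  { element = λ _ → x₀ ; injective = λ _ → refl ; sound = λ _ → refl ; complete = λ eq → tt , sym eq }

enum-⊥ : (∀ {x} → ¬ P x) → Enumeration ⊥ P
enum-⊥ ¬P = record
  { element = λ () ; injective = λ {} ; sound = λ () ; complete = λ px → ⊥-elim (¬P px) }

enum-⊎ : Enumeration I P → Enumeration J Q → (∀ {x} → P x → ¬ Q x) →
         Enumeration (I ⊎ J) (P ∪ Q)
enum-⊎ {Q = Q} E E′ disjoint = record
  { element   = [ element E , element E′ ]′
  ; injective = inj
  ; sound     = λ { (inj₁ i) → inj₁ (sound E i) ; (inj₂ j) → inj₂ (sound E′ j) }
  ; complete  = λ { (inj₁ px) → let (i , eq) = complete E px in inj₁ i , eq
                  ; (inj₂ qx) → let (j , eq) = complete E′ qx in inj₂ j , eq }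
  }
  where
  inj : Injective _≡_ _≡_ [ element E , element E′ ]′
  inj {inj₁ i} {inj₁ i′} eq = cong inj₁ (injective E eq)
  inj {inj₂ j} {inj₂ j′} eq = cong inj₂ (injective E′ eq)
  inj {inj₁ i} {inj₂ j}  eq = ⊥-elim (disjoint (sound E i) (subst Q (sym eq) (sound E′ j)))
  inj {inj₂ j} {inj₁ i}  eq = ⊥-elim (disjoint (sound E i) (subst Q eq (sound E′ j)))

_⊗_ : (List A → Set) → (List A → Set) → (List A → Set)
(P ⊗ Q) x = ∃₂ λ y z → x ≡ y ++ z × P y × Q z

UniqueSplit : (List A → Set) → (List A → Set) → Set
UniqueSplit P Q = ∀ {y z y′ z′} → P y → Q z → P y′ → Q z′ → y ++ z ≡ y′ ++ z′ → y ≡ y′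

enum-× : {P Q : List A → Set} → Enumeration I P → Enumeration J Q → UniqueSplit P Q →
         Enumeration (I × J) (P ⊗ Q)
enum-× E E′ split = record
  { element   = λ (i , j) → element E i ++ element E′ j
  ; injective = inj
  ; sound     = λ (i , j) → _ , _ , refl , sound E i , sound E′ j
  ; complete  = λ { (y , z , refl , py , qz) →
                    let (i , eqy) = complete E py ; (j , eqz) = complete E′ qz in
                    (i , j) , cong₂ _++_ eqy eqz }
  }
  where
  inj : Injective _≡_ _≡_ (λ (i , j) → element E i ++ element E′ j)
  inj {i , j} {i′ , j′} eq =
    cong₂ _,_ (injective E same-prefix)
              (injective E′ (++-cancelˡ (element E i) _ _ (trans eq (cong (_++ _) (sym same-prefix)))))
    where
    same-prefix : element E i ≡ element E i′
    same-prefix = split (sound E i) (sound E′ j) (sound E i′) (sound E′ j′) eq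

enum-+ : ∀ {m n} → Enumeration (Fin m) P → Enumeration (Fin n) Q → (∀ {x} → P x → ¬ Q x) →
         Enumeration (Fin (m + n)) (P ∪ Q)
enum-+ E E′ disjoint = enum-reindex +↔⊎ (enum-⊎ E E′ disjoint)

enum-* : ∀ {m n} {P Q : List A → Set} → Enumeration (Fin m) P → Enumeration (Fin n) Q → UniqueSplit P Q →
         Enumeration (Fin (m * n)) (P ⊗ Q)
enum-* E E′ split = enum-reindex *↔× (enum-× E E′ split)

enum-sumTo : ∀ n {h : ℕ → ℕ} {Q : ℕ → A → Set} → (∀ s → Enumeration (Fin (h s)) (Q s)) →
             (∀ {s t x} → Q s x → Q t x → s ≡ t) →
             Enumeration (Fin (sumTo n h)) (λ x → ∃ λ s → s ≤ n × Q s x)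
enum-sumTo zero    E unique = enum-⇔ (mk⇔ (λ q → 0 , z≤n , q) (λ { (0 , z≤n , q) → q })) (E 0)
enum-sumTo (suc n) {Q = Q} E unique =
  enum-⇔ (mk⇔ to from) (enum-+ (enum-sumTo n E unique) (E (suc n)) disjoint)
  where
  disjoint : ∀ {x} → (∃ λ s → s ≤ n × Q s x) → ¬ Q (suc n) x
  disjoint (s , s≤n , q) q′ = <-irrefl (unique q q′) (s≤s s≤n)
  to : ∀ {x} → (∃ λ s → s ≤ n × Q s x) ⊎ Q (suc n) x → ∃ λ s → s ≤ suc n × Q s x
  to (inj₁ (s , s≤n , q)) = s , m≤n⇒m≤1+n s≤n , q
  to (inj₂ q)             = suc n , ≤-refl , q
  from : ∀ {x} → (∃ λ s → s ≤ suc n × Q s x) → (∃ λ s → s ≤ n × Q s x) ⊎ Q (suc n) x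
  from (s , s≤1+n , q) with m≤n⇒m<n∨m≡n s≤1+n
  ... | inj₁ (s≤s s≤n) = inj₁ (s , s≤n , q)
  ... | inj₂ refl      = inj₂ q

enum-∷⁻ : ∀ {t : A} {P : List A → Set} → (∀ {x} → P x → ∃ λ r → x ≡ t ∷ r) →
          Enumeration I P → Enumeration I (P ∘ (t ∷_))
enum-∷⁻ {t = t} {P} form E = record
  { element   = proj₁ ∘ form ∘ sound E
  ; injective = λ {i} {j} eq → injective E (trans (shape i) (trans (cong (t ∷_) eq) (sym (shape j))))
  ; sound     = λ i → subst P (shape i) (sound E i)
  ; complete  = λ p → let (i , eq) = complete E p in i , ∷-injectiveʳ (trans (sym (shape i)) eq)
  }
  where
  shape : ∀ i → element E i ≡ t ∷ proj₁ (form (sound E i))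
  shape i = proj₂ (form (sound E i))

enum-empty : ∀ {N} → Enumeration (Fin N) P → (∀ {x} → ¬ P x) → N ≡ 0
enum-empty {N = zero}  _ _  = refl
enum-empty {N = suc N} E ¬P = ⊥-elim (¬P (sound E zero))

-- Weighted words and the series operations

Word : Set
Word = List ℕ

pieceOf : ℕ → Piece
pieceOf zero    = monomer
pieceOf (suc k) = dimer k

letterSize letterLeft : ℕ → ℕ
letterSize t = size (pieceOf t)
letterLeft t = leftAbs (pieceOf t)

ySum pSum : Word → ℕ
ySum = sum ∘ map letterSize
pSum = sum ∘ map letterLeft

HasWeight : ℕ → ℕ → ℕ → Word → Set
HasWeight a b c x = length x ≡ a × ySum x ≡ b × pSum x ≡ c

Enumerates : Series → (Word → Set) → Set
Enumerates f P = ∀ a b c → Enumeration (Fin (f a b c)) (P ∩ HasWeight a b c)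

Additive : (Word → ℕ) → Set
Additive wt = ∀ x y → wt (x ++ y) ≡ wt x + wt y

sumMap-additive : ∀ f → Additive (sum ∘ map f)
sumMap-additive f x y = trans (cong sum (map-++ f x y)) (sum-++ (map f x) (map f y))

module _ {wt : Word → ℕ} (additive : Additive wt) (y z : Word) where

  additive-join : ∀ {i a} → i ≤ a → wt y ≡ i → wt z ≡ a ∸ i → wt (y ++ z) ≡ a
  additive-join i≤a refl wz = trans (additive y z) (trans (cong (wt y +_) wz) (m+[n∸m]≡n i≤a))

  additive-split : ∀ {a} → wt (y ++ z) ≡ a → wt y ≤ a × wt z ≡ a ∸ wt y
  additive-split refl = subst (wt y ≤_) (sym (additive y z)) (m≤m+n (wt y) (wt z)) ,
                        trans (sym (m+n∸m≡n (wt y) (wt z))) (cong (_∸ wt y) (sym (additive y z)))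

hasWeight-++ : ∀ {i j k a b c y z} → i ≤ a → j ≤ b → k ≤ c → HasWeight i j k y →
               HasWeight (a ∸ i) (b ∸ j) (c ∸ k) z → HasWeight a b c (y ++ z)
hasWeight-++ {y = y} {z} i≤a j≤b k≤c (ly , yy , py) (lz , yz , pz) =
  additive-join (λ x _ → length-++ x) y z i≤a ly lz ,
  additive-join (sumMap-additive letterSize) y z j≤b yy yz ,
  additive-join (sumMap-additive letterLeft) y z k≤c py pz

hasWeight-++⁻ : ∀ {a b c} y {z} → HasWeight a b c (y ++ z) →
                (length y ≤ a × ySum y ≤ b × pSum y ≤ c) ×
                HasWeight (a ∸ length y) (b ∸ ySum y) (c ∸ pSum y) z
hasWeight-++⁻ y {z} (l , yw , pw)
  with additive-split (λ x _ → length-++ x) y z l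
     | additive-split (sumMap-additive letterSize) y z yw
     | additive-split (sumMap-additive letterLeft) y z pw
... | (l≤ , lz) | (y≤ , yz) | (p≤ , pz) = (l≤ , y≤ , p≤) , (lz , yz , pz)

weight-test⇔ : ∀ a b c A B C → T ((a ≡ᵇ A) ∧ (b ≡ᵇ B) ∧ (c ≡ᵇ C)) ⇔ (a ≡ A × b ≡ B × c ≡ C)
weight-test⇔ a b c A B C = ⇔.trans T-∧ (≡ᵇ⇔≡ a A ×-⇔ ⇔.trans T-∧ (≡ᵇ⇔≡ b B ×-⇔ ≡ᵇ⇔≡ c C))
  where
  ≡ᵇ⇔≡ : ∀ m n → T (m ≡ᵇ n) ⇔ m ≡ n
  ≡ᵇ⇔≡ m n = mk⇔ (≡ᵇ⇒≡ m n) (≡⇒≡ᵇ m n)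

enumerates-monomial : ∀ {A B C} x₀ → HasWeight A B C x₀ → Enumerates (monomial A B C) (_≡ x₀)
enumerates-monomial {A} {B} {C} x₀ w₀@(l₀ , y₀ , p₀) a b c with (a ≡ᵇ A) ∧ (b ≡ᵇ B) ∧ (c ≡ᵇ C) in test
... | true  = enum-reindex 1↔⊤ (enum-⇔ (mk⇔ (λ { refl → refl , weight }) proj₁) (enum-⊤ x₀))
  where
  weight : HasWeight a b c x₀
  weight with Equivalence.to (weight-test⇔ a b c A B C) (subst T (sym test) tt)
  ... | refl , refl , refl = w₀
... | false = enum-reindex 0↔⊥ (enum-⊥ λ { (refl , l , y , p) →
                subst T test (Equivalence.from (weight-test⇔ a b c A B C)
                                               (trans (sym l) l₀ , trans (sym y) y₀ , trans (sym p) p₀)) })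

-- (f ⊛ g) a b c sums over the weight (i, j, k) of the P-part; unique splitting makes the summands disjoint.
enumerates-⊛ : ∀ {f g P Q} → Enumerates f P → Enumerates g Q → UniqueSplit P Q → Enumerates (f ⊛ g) (P ⊗ Q)
enumerates-⊛ {P = P} {Q} Ef Eg split a b c =
  enum-⇔ (mk⇔ to from)
    (enum-sumTo a (λ i → enum-sumTo b (λ j → enum-sumTo c (λ k →
        enum-* (Ef i j k) (Eg (a ∸ i) (b ∸ j) (c ∸ k)) λ (py , _) (qz , _) (py′ , _) (qz′ , _) → split py qz py′ qz′)
      (λ p p′ → proj₂ (proj₂ (parts-agree p p′))))
      (λ (_ , _ , p) (_ , _ , p′) → proj₁ (proj₂ (parts-agree p p′))))
      (λ (_ , _ , _ , _ , p) (_ , _ , _ , _ , p′) → proj₁ (parts-agree p p′)))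
  where
  Part : ℕ → ℕ → ℕ → Word → Set
  Part i j k = (P ∩ HasWeight i j k) ⊗ (Q ∩ HasWeight (a ∸ i) (b ∸ j) (c ∸ k))

  parts-agree : ∀ {i j k i′ j′ k′ x} → Part i j k x → Part i′ j′ k′ x → i ≡ i′ × j ≡ j′ × k ≡ k′
  parts-agree (y , z , refl , (py , refl , refl , refl) , (qz , _)) (y′ , z′ , eq , (py′ , refl , refl , refl) , (qz′ , _))
    with split py qz py′ qz′ eq
  ... | refl = refl , refl , refl

  to : ∀ {x} → (∃ λ i → i ≤ a × ∃ λ j → j ≤ b × ∃ λ k → k ≤ c × Part i j k x) → ((P ⊗ Q) ∩ HasWeight a b c) x
  to (i , i≤a , j , j≤b , k , k≤c , y , z , refl , (py , wy) , (qz , wz)) =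
    (y , z , refl , py , qz) , hasWeight-++ {y = y} {z} i≤a j≤b k≤c wy wz

  from : ∀ {x} → ((P ⊗ Q) ∩ HasWeight a b c) x → ∃ λ i → i ≤ a × ∃ λ j → j ≤ b × ∃ λ k → k ≤ c × Part i j k x
  from ((y , z , refl , py , qz) , w) with hasWeight-++⁻ y w
  ... | (i≤a , j≤b , k≤c) , wz = _ , i≤a , _ , j≤b , _ , k≤c , y , z , refl , (py , refl , refl , refl) , (qz , wz)

Power : (List A → Set) → ℕ → List A → Set
Power P zero    = _≡ []
Power P (suc k) = P ⊗ Power P k

Star : (List A → Set) → List A → Set
Star P x = ∃ λ k → Power P k x

module _ {P : List A → Set} (¬P[] : ¬ P []) where

  power-length : ∀ {k x} → Power P k x → k ≤ length x
  power-length {zero}  _                          = z≤n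
  power-length {suc k} (y , z , refl , py , pz) =
    subst (suc k ≤_) (sym (length-++ y)) (+-mono-≤ (nonempty py) (power-length pz))
    where
    nonempty : ∀ {y} → P y → 1 ≤ length y
    nonempty {[]}    py = ⊥-elim (¬P[] py)
    nonempty {_ ∷ _} _  = s≤s z≤n

  power-unique : UniqueSplit P (Star P) → ∀ {k k′ x} → Power P k x → Power P k′ x → k ≡ k′
  power-unique split {zero}  {zero}   _ _ = refl
  power-unique split {zero}  {suc k′} refl (y , z , eq , py , _) = ⊥-elim (¬P[] (subst P (++-conicalˡ y z (sym eq)) py))
  power-unique split {suc k} {zero}   (y , z , eq , py , _) refl = ⊥-elim (¬P[] (subst P (++-conicalˡ y z (sym eq)) py))
  power-unique split {suc k} {suc k′} (y , z , refl , py , pz) (y′ , z′ , eq , py′ , pz′)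
    with split py (k , pz) py′ (k′ , pz′) eq
  ... | refl = cong suc (power-unique split pz (subst (Power P k′) (sym (++-cancelˡ y z z′ eq)) pz′))

enumerates-pow : ∀ {f P} → Enumerates f P → UniqueSplit P (Star P) → ∀ k → Enumerates (pow f k) (Power P k)
enumerates-pow Ef split zero    = enumerates-monomial [] (refl , refl , refl)
enumerates-pow Ef split (suc k) =
  enumerates-⊛ Ef (enumerates-pow Ef split k) λ py pz py′ pz′ → split py (k , pz) py′ (k , pz′)

enumerates-geom : ∀ {f P} → Enumerates f P → ¬ P [] → UniqueSplit P (Star P) → Enumerates (geom f) (Star P)
enumerates-geom {P = P} Ef ¬P[] split a b c =
  enum-⇔ (mk⇔ to from)
    (enum-sumTo a (λ k → enumerates-pow Ef split k a b c) λ (p , _) (p′ , _) → power-unique ¬P[] split p p′)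
  where
  to : ∀ {x} → (∃ λ k → k ≤ a × (Power P k ∩ HasWeight a b c) x) → (Star P ∩ HasWeight a b c) x
  to (k , _ , p , w) = (k , p) , w
  from : ∀ {x} → (Star P ∩ HasWeight a b c) x → ∃ λ k → k ≤ a × (Power P k ∩ HasWeight a b c) x
  from ((k , p) , w) = k , subst (k ≤_) (proj₁ w) (power-length ¬P[] p) , p , w

-- Words of the continued fraction

module _ {R : A → A → Set} where

  linked-++⁻ˡ : ∀ xs {ys} → Linked R (xs ++ ys) → Linked R xs
  linked-++⁻ˡ []           _        = []
  linked-++⁻ˡ (x ∷ [])     _        = [-]
  linked-++⁻ˡ (x ∷ y ∷ xs) (r ∷ rs) = r ∷ linked-++⁻ˡ (y ∷ xs) rs

  linked-++⁻ʳ : ∀ xs {ys} → Linked R (xs ++ ys) → Linked R ys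
  linked-++⁻ʳ []       l = l
  linked-++⁻ʳ (x ∷ xs) l = linked-++⁻ʳ xs (Linked.tail l)

CanFollow : ℕ → ℕ → Set
CanFollow s t = t ≤ suc s

NormalWord : Word → Set
NormalWord = Linked CanFollow

HeadIs : ℕ → Word → Set
HeadIs i []      = ⊤
HeadIs i (t ∷ _) = t ≡ i

record Rooted (i : ℕ) (x : Word) : Set where
  field
    above  : All (i ≤_) x
    starts : HeadIs i x
    normal : NormalWord x

open Rooted

normal-++ : ∀ {i} xs {ys} → NormalWord xs → All (i ≤_) xs → NormalWord ys → HeadIs i ys → NormalWord (xs ++ ys)
normal-++ []           _        _           nys _    = nys
normal-++ (x ∷ [])     {[]}     _ _         _   _    = [-]
normal-++ (x ∷ [])     {_ ∷ _}  _ (i≤x ∷ _) nys refl = ≤-trans i≤x (n≤1+n x) ∷ nys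
normal-++ (x ∷ y ∷ xs) (r ∷ rs) (_ ∷ above) nys hys  = r ∷ normal-++ (y ∷ xs) rs above nys hys

rooted-block : ∀ {i u z} → Rooted (suc i) u → Rooted i z → Rooted i (i ∷ u ++ z)
rooted-block {i} {u} ru rz = record
  { above  = ≤-refl ∷ All.++⁺ (All.map <⇒≤ (above ru)) (above rz)
  ; starts = refl
  ; normal = normal-++ (i ∷ u) (block-normal u (starts ru) (normal ru)) (≤-refl ∷ All.map <⇒≤ (above ru))
                       (normal rz) (starts rz)
  }
  where
  block-normal : ∀ u → HeadIs (suc i) u → NormalWord u → NormalWord (i ∷ u)
  block-normal []      _    _  = [-]
  block-normal (_ ∷ _) refl nu = ≤-refl ∷ nu

splitAbove : ∀ {i} xs → All (i ≤_) xs → ∃₂ λ u z → xs ≡ u ++ z × All (suc i ≤_) u × HeadIs i z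
splitAbove []       _ = [] , [] , refl , [] , tt
splitAbove {i} (t ∷ xs) (i≤t ∷ above) with i ≟ t
... | yes refl = [] , t ∷ xs , refl , [] , refl
... | no  i≢t with splitAbove xs above
...   | u , z , refl , above-u , starts-z = t ∷ u , z , refl , ≤∧≢⇒< i≤t i≢t ∷ above-u , starts-z

rooted-unblock : ∀ {i rest} → Rooted i (i ∷ rest) → ∃₂ λ u z → rest ≡ u ++ z × Rooted (suc i) u × Rooted i z
rooted-unblock {i} {rest} root with above root | normal root
... | _ ∷ above-rest | normal-rest with splitAbove rest above-rest
...   | u , z , refl , above-u , starts-z =
  u , z , refl ,
  record { above = above-u ; starts = starts-u u above-u normal-rest ; normal = linked-++⁻ˡ u (Linked.tail normal-rest) } ,
  record { above = All.++⁻ʳ u above-rest ; starts = starts-z ; normal = linked-++⁻ʳ u (Linked.tail normal-rest) }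
  where
  starts-u : ∀ u {z} → All (suc i ≤_) u → NormalWord (i ∷ u ++ z) → HeadIs (suc i) u
  starts-u []      _           _       = tt
  starts-u (t ∷ _) (i<t ∷ _) (t≤1+i ∷ _) = ≤-antisym t≤1+i i<t

prefix-unique : ∀ {i} u u′ {z z′} → All (suc i ≤_) u → All (suc i ≤_) u′ → HeadIs i z → HeadIs i z′ →
                u ++ z ≡ u′ ++ z′ → u ≡ u′
prefix-unique []      []       _         _          _      _      _    = refl
prefix-unique []      (t ∷ u′) _         (i<t ∷ _)  t≡i    _      refl = ⊥-elim (<-irrefl (sym t≡i) i<t)
prefix-unique (t ∷ u) []       (i<t ∷ _) _          _      t≡i    refl = ⊥-elim (<-irrefl (sym t≡i) i<t)
prefix-unique (t ∷ u) (t′ ∷ u′) (_ ∷ au) (_ ∷ au′)  hz     hz′    eq   =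
  let (t≡t′ , rest) = ∷-injective eq in cong₂ _∷_ t≡t′ (prefix-unique u u′ au au′ hz hz′ rest)

Block : ℕ → (Word → Set) → Word → Set
Block i Q = (_≡ [ i ]) ⊗ Q

CFWord : ℕ → ℕ → Word → Set
CFWord zero    i = _≡ []
CFWord (suc d) i = Star (Block i (CFWord d (suc i)))

cfWord⇒rooted : ∀ d {i x} → CFWord d i x → Rooted i x
blocks⇒rooted : ∀ d {i} k {x} → Power (Block i (CFWord d (suc i))) k x → Rooted i x

cfWord⇒rooted zero    refl    = record { above = [] ; starts = tt ; normal = [] }
cfWord⇒rooted (suc d) (k , p) = blocks⇒rooted d k p

blocks⇒rooted d zero    refl = record { above = [] ; starts = tt ; normal = [] }
blocks⇒rooted d (suc k) (_ , _ , refl , (_ , u , refl , refl , cu) , pz) =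
  rooted-block (cfWord⇒rooted d cu) (blocks⇒rooted d k pz)

rooted⇒cfWord : ∀ {d i} x → length x < d → Rooted i x → CFWord d i x
rooted⇒cfWord x = go x (<-wellFounded (length x))
  where
  go : ∀ {d i} x → Acc _<_ (length x) → length x < d → Rooted i x → CFWord d i x
  go []         _        (s≤s _)       _    = 0 , refl
  go (t ∷ rest) (acc rs) (s≤s rest<d) root with starts root
  ... | refl with rooted-unblock root
  ...   | u , z , refl , ru , rz =
    let (k , pz) = go z (rs (s≤s z≤rest)) (s≤s (≤-trans z≤rest (≤-trans (n≤1+n _) rest<d))) rz in
    suc k , t ∷ u , z , refl , ([ t ] , u , refl , refl , go u (rs (s≤s u≤rest)) (≤-trans (s≤s u≤rest) rest<d) ru) , pz
    where
    u≤rest : length u ≤ length (u ++ z)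
    u≤rest = subst (length u ≤_) (sym (length-++ u)) (m≤m+n _ _)
    z≤rest : length z ≤ length (u ++ z)
    z≤rest = subst (length z ≤_) (sym (length-++ u)) (m≤n+m _ _)

enumerates-letter : ∀ t → Enumerates (monomial 1 (letterSize t) (letterLeft t)) (_≡ [ t ])
enumerates-letter t = enumerates-monomial [ t ] (refl , +-identityʳ _ , +-identityʳ _)

enumerates-cfCoeff : ∀ i → Enumerates (cfCoeff i) (_≡ [ i ])
enumerates-cfCoeff zero    = enumerates-letter 0
enumerates-cfCoeff (suc i) = enumerates-letter (suc i)

enumerates-cfTrunc : ∀ d i → Enumerates (cfTrunc d i) (CFWord d i)
enumerates-cfTrunc zero    i = enumerates-monomial [] (refl , refl , refl)
enumerates-cfTrunc (suc d) i =
  enumerates-geom (enumerates-⊛ (enumerates-cfCoeff i) (enumerates-cfTrunc d (suc i)) λ { refl _ refl _ _ → refl })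
                  (λ { (_ , _ , () , refl , _) })
                  unique
  where
  unique : UniqueSplit (Block i (CFWord d (suc i))) (Star (Block i (CFWord d (suc i))))
  unique (_ , u , refl , refl , cu) sz (_ , u′ , refl , refl , cu′) sz′ eq =
    cong (i ∷_) (prefix-unique u u′ (above (cfWord⇒rooted d cu)) (above (cfWord⇒rooted d cu′))
                               (starts (cfWord⇒rooted (suc d) sz)) (starts (cfWord⇒rooted (suc d) sz′))
                               (proj₂ (∷-injective eq)))

-- Pieces as letters; isomorphic heaps

letterOf : Piece → ℕ
letterOf monomer   = 0
letterOf (dimer k) = suc k

pieceOf-letterOf : ∀ P → pieceOf (letterOf P) ≡ P
pieceOf-letterOf monomer   = refl
pieceOf-letterOf (dimer k) = refl

letterOf-pieceOf : ∀ t → letterOf (pieceOf t) ≡ t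
letterOf-pieceOf zero    = refl
letterOf-pieceOf (suc t) = refl

pieceOf-injective : Injective _≡_ _≡_ pieceOf
pieceOf-injective {s} {t} eq = trans (sym (letterOf-pieceOf s)) (trans (cong letterOf eq) (letterOf-pieceOf t))

leftAbs≤rightAbs⇔ : ∀ P Q → T (leftAbs P ≤ᵇ rightAbs Q) ⇔ letterOf P ≤ suc (letterOf Q)
leftAbs≤rightAbs⇔ monomer   monomer   = mk⇔ (λ _ → z≤n) (λ _ → tt)
leftAbs≤rightAbs⇔ monomer   (dimer _) = mk⇔ (λ _ → z≤n) (λ _ → tt)
leftAbs≤rightAbs⇔ (dimer _) monomer   = mk⇔ (≤ᵇ⇒≤ _ _) ≤⇒≤ᵇ
leftAbs≤rightAbs⇔ (dimer _) (dimer _) = mk⇔ (≤ᵇ⇒≤ _ _) ≤⇒≤ᵇ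

concurrent⇔ : ∀ {P Q} → Concurrent P Q ⇔ (letterOf P ≤ suc (letterOf Q) × letterOf Q ≤ suc (letterOf P))
concurrent⇔ {P} {Q} = ⇔.trans T-∧ (leftAbs≤rightAbs⇔ P Q ×-⇔ leftAbs≤rightAbs⇔ Q P)

concurrent-sym : ∀ {P Q} → Concurrent P Q → Concurrent Q P
concurrent-sym {P} {Q} c = let (p , q) = Equivalence.to (concurrent⇔ {P} {Q}) c in Equivalence.from concurrent⇔ (q , p)

letters-concurrent : ∀ {s t} → s ≤ suc t → t ≤ suc s → Concurrent (pieceOf s) (pieceOf t)
letters-concurrent {s} {t} s≤ t≤ =
  Equivalence.from concurrent⇔
    (subst₂ (λ a b → a ≤ suc b × b ≤ suc a) (sym (letterOf-pieceOf s)) (sym (letterOf-pieceOf t)) (s≤ , t≤))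

leftAbs≡1⇔ : ∀ {t} → leftAbs (pieceOf t) ≡ 1 ⇔ t ≤ 1
leftAbs≡1⇔ {zero}        = mk⇔ (λ _ → z≤n) (λ _ → refl)
leftAbs≡1⇔ {suc zero}    = mk⇔ (λ _ → s≤s z≤n) (λ _ → refl)
leftAbs≡1⇔ {suc (suc t)} = mk⇔ (λ ()) (λ { (s≤s ()) })

sumFin-cong : ∀ {n} {f g : Fin n → ℕ} → (∀ i → f i ≡ g i) → sumFin n f ≡ sumFin n g
sumFin-cong {zero}  eq = refl
sumFin-cong {suc n} eq = cong₂ _+_ (eq zero) (sumFin-cong (eq ∘ suc))

sumFin≡∑ : ∀ n (f : Fin n → ℕ) → sumFin n f ≡ ∑ f
sumFin≡∑ zero    f = refl
sumFin≡∑ (suc n) f = cong (f zero +_) (sumFin≡∑ n (f ∘ suc))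

sumFin-permute : ∀ {n} (π : Permutation′ n) (f : Fin n → ℕ) → sumFin n (f ∘ (π ⟨$⟩ʳ_)) ≡ sumFin n f
sumFin-permute {n} π f = begin
  sumFin n (f ∘ (π ⟨$⟩ʳ_)) ≡⟨ sumFin≡∑ n _ ⟩
  ∑ (f ∘ (π ⟨$⟩ʳ_))        ≡⟨ sum-permute f π ⟨
  ∑ f                      ≡⟨ sumFin≡∑ n f ⟨
  sumFin n f               ∎
  where open ≡-Reasoning

iso-sym : ∀ {n} {H K : Heap n} → Iso H K → Iso K H
iso-sym {K = K} (π , labels , order) =
  Perm.flip π ,
  (λ j → trans (sym (labels (π ⟨$⟩ˡ j))) (cong (label K) (inverseʳ π))) ,
  (λ i j → trans (sym (order (π ⟨$⟩ˡ i) (π ⟨$⟩ˡ j))) (cong₂ (leq K) (inverseʳ π) (inverseʳ π)))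

iso-≼⇔ : ∀ {n} {H K : Heap n} ((π , _) : Iso H K) → ∀ {i j} → _≼_ K (π ⟨$⟩ʳ i) (π ⟨$⟩ʳ j) ⇔ _≼_ H i j
iso-≼⇔ (_ , _ , order) {i} {j} = mk⇔ (subst T (order i j)) (subst T (sym (order i j)))

iso-maximal : ∀ {n} {H K : Heap n} ((π , _) : Iso H K) → ∀ {m} → Maximal H m → Maximal K (π ⟨$⟩ʳ m)
iso-maximal {H = H} {K} iso@(π , _) {m} max j m≼j =
  trans (sym (inverseʳ π))
        (cong (π ⟨$⟩ʳ_) (max (π ⟨$⟩ˡ j) (Equivalence.to (iso-≼⇔ {H = H} {K} iso {m} {π ⟨$⟩ˡ j})
                                                        (subst (_≼_ K _) (sym (inverseʳ π)) m≼j))))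

iso-semiPyramid : ∀ {n} {H K : Heap n} → Iso H K → SemiPyramid H → SemiPyramid K
iso-semiPyramid {H = H} {K} iso@(π , labels , _) (m , max , unique , left) =
  π ⟨$⟩ʳ m , iso-maximal {H = H} {K} iso max ,
  (λ j max-j → trans (sym (inverseʳ π))
                      (cong (π ⟨$⟩ʳ_) (unique (π ⟨$⟩ˡ j) (iso-maximal {H = K} {H} (iso-sym {H = H} {K} iso) max-j)))) ,
  trans (cong leftAbs (labels m)) left

iso-sumFin : ∀ {n} {H K : Heap n} → Iso H K → ∀ (f : Piece → ℕ) → sumFin n (f ∘ label K) ≡ sumFin n (f ∘ label H)
iso-sumFin {K = K} (π , labels , _) f = trans (sym (sumFin-permute π (f ∘ label K))) (sumFin-cong λ i → cong f (labels i))

-- The heap of a word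

-- Position 0 is the top of the heap: i ≼ j when a chain of overlapping pieces descends from j to i.
module _ {n : ℕ} (w : ℕ → ℕ) where

  Overlap : Fin n → Fin n → Set
  Overlap k q = Concurrent (pieceOf (w (toℕ k))) (pieceOf (w (toℕ q)))

  overlap-sym : ∀ {k q} → Overlap k q → Overlap q k
  overlap-sym {k} {q} = concurrent-sym {pieceOf (w (toℕ k))} {pieceOf (w (toℕ q))}

  data Reach (p : Fin n) : Fin n → Set where
    here : Reach p p
    step : ∀ {k q} → Reach p k → k Fin.< q → Overlap k q → Reach p q

  reach-≤ : ∀ {p q} → Reach p q → p Fin.≤ q
  reach-≤ here           = Fin.≤-refl
  reach-≤ (step r k<q _) = ≤-trans (reach-≤ r) (<⇒≤ k<q)

  reach-trans : ∀ {p q r} → Reach p q → Reach q r → Reach p r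
  reach-trans r here              = r
  reach-trans r (step r′ k<q o)   = step (reach-trans r r′) k<q o

  reach? : ∀ p q → Dec (Reach p q)
  reach? p q = go q (Fin.<-wellFounded q)
    where
    last-step : ∀ {q} → p ≢ q → Reach p q → ∃ λ k → k Fin.< q × Reach p k × Overlap k q
    last-step p≢q here           = ⊥-elim (p≢q refl)
    last-step _   (step r k<q o) = _ , k<q , r , o
    go : ∀ q → Acc Fin._<_ q → Dec (Reach p q)
    go q (acc below) with p Fin.≟ q
    ... | yes refl = yes here
    ... | no  p≢q  = map′ (λ (_ , k<q , r , o) → step r k<q o) (last-step p≢q) (Fin.any? before?)
      where
      before? : ∀ k → Dec (k Fin.< q × Reach p k × Overlap k q)
      before? k with k Fin.<? q
      ... | yes k<q = map′ (k<q ,_) proj₂ (go k (below k<q) ×-dec T? _)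
      ... | no  k≮q = no (k≮q ∘ proj₁)

  above⇔reach : ∀ {i j} → True (reach? j i) ⇔ Reach j i
  above⇔reach {i} {j} = mk⇔ (toWitness {a? = reach? j i}) fromWitness

  wordHeap : Heap n
  wordHeap = record
    { label                  = λ i → pieceOf (w (toℕ i))
    ; leq                    = λ i j → isYes (reach? j i)
    ; ≼-refl                 = λ i → fromWitness here
    ; ≼-antisym              = λ i j i≼j j≼i → Fin.≤-antisym (reach-≤ (to j≼i)) (reach-≤ (to i≼j))
    ; ≼-trans                = λ i j k i≼j j≼k → from (reach-trans (to j≼k) (to i≼j))
    ; concurrent⇒comparable = λ i j o → Sum.map from from (comparable i j o)
    ; cover⇒concurrent       = λ i j ((i≼j , i≢j) , nothing-between) →
                                 cover-overlap i≢j (to i≼j) λ k (k→i , i≢k) (j→k , k≢j) →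
                                   nothing-between k ((from k→i , i≢k) , (from j→k , k≢j))
    }
    where
    to : ∀ {i j} → True (reach? j i) → Reach j i
    to = Equivalence.to above⇔reach
    from : ∀ {i j} → Reach j i → True (reach? j i)
    from = Equivalence.from above⇔reach
    comparable : ∀ i j → Overlap i j → Reach j i ⊎ Reach i j
    comparable i j o with Fin.<-cmp i j
    ... | tri< i<j _ _ = inj₂ (step here i<j o)
    ... | tri≈ _ refl _ = inj₁ here
    ... | tri> _ _ j<i = inj₁ (step here j<i (overlap-sym o))
    cover-overlap : ∀ {i j} → i ≢ j → Reach j i →
                    (∀ k → (Reach k i × i ≢ k) → (Reach j k × k ≢ j) → ⊥) → Overlap i j
    cover-overlap i≢j here _ = ⊥-elim (i≢j refl)
    cover-overlap {j = j} i≢j (step {k} r k<i o) nothing-between with k Fin.≟ j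
    ... | yes refl = overlap-sym o
    ... | no  k≢j  = ⊥-elim (nothing-between k (step here k<i o , λ { refl → Fin.<-irrefl refl k<i }) (r , k≢j))

letterAt : Word → ℕ → ℕ
letterAt []      _       = 0
letterAt (t ∷ _) zero    = t
letterAt (_ ∷ x) (suc k) = letterAt x k

NormalUpTo : ℕ → (ℕ → ℕ) → Set
NormalUpTo n w = ∀ k → suc k < n → CanFollow (w k) (w (suc k))

normal-letterAt : ∀ {x} → NormalWord x → NormalUpTo (length x) (letterAt x)
normal-letterAt (r ∷ _)  zero    _         = r
normal-letterAt (_ ∷ rs) (suc k) (s≤s k<n) = normal-letterAt rs k k<n
normal-letterAt [-]      _       (s≤s ())

module _ {n} {w : ℕ → ℕ} (normal : NormalUpTo n w) where

  -- Going down from q - 1, normality keeps w q ≤ 1 + w m until some w m ≤ 1 + w q.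
  overlap-before : ∀ {p q} → p < q → q < n → w p ≤ suc (w q) →
                   ∃ λ k → p ≤ k × k < q × w k ≤ suc (w q) × w q ≤ suc (w k)
  overlap-before {p} {suc m₀} (s≤s p≤m₀) q<n wp = descend m₀ p≤m₀ ≤-refl (normal m₀ q<n)
    where
    q : ℕ
    q = suc m₀
    descend : ∀ m → p ≤ m → m < q → w q ≤ suc (w m) → ∃ λ k → p ≤ k × k < q × w k ≤ suc (w q) × w q ≤ suc (w k)
    descend m p≤m m<q wq with w m ≤? suc (w q)
    ... | yes wm = m , p≤m , m<q , wm , wq
    descend zero    z≤n _ _ | no wm = ⊥-elim (wm wp)
    descend (suc m) p≤m m<q _ | no wm with p ≟ suc m
    ... | yes refl = ⊥-elim (wm wp)
    ... | no  p≢m  = descend m (≤-pred (≤∧≢⇒< p≤m p≢m)) (<-trans (n<1+n m) m<q) wq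
      where
      -- 2 + w q ≤ w (1 + m) ≤ 1 + w m
      wq : w q ≤ suc (w m)
      wq = ≤-trans (n≤1+n _) (≤-trans (≤-pred (≤-trans (≰⇒> wm) (normal m (<-trans m<q q<n)))) (n≤1+n _))

  overlap-before-fin : ∀ {p q : Fin n} → p Fin.< q → w (toℕ p) ≤ suc (w (toℕ q)) →
                       ∃ λ k → p Fin.≤ k × k Fin.< q × Overlap w k q
  overlap-before-fin {p} {q} p<q wp with overlap-before p<q (Fin.toℕ<n q) wp
  ... | k , p≤k , k<q , wk , wq =
    fromℕ< (<-trans k<q (Fin.toℕ<n q)) ,
    subst (toℕ p ≤_) (sym toℕ-k) p≤k , subst (_< toℕ q) (sym toℕ-k) k<q ,
    subst (λ j → Concurrent (pieceOf (w j)) _) (sym toℕ-k) (letters-concurrent wk wq)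
    where
    toℕ-k : toℕ (fromℕ< (<-trans k<q (Fin.toℕ<n q))) ≡ k
    toℕ-k = Fin.toℕ-fromℕ< (<-trans k<q (Fin.toℕ<n q))

top-maximal : ∀ {n} (w : ℕ → ℕ) → Maximal (wordHeap {suc n} w) zero
top-maximal w j 0≼j = Fin.toℕ-injective (n≤0⇒n≡0 (reach-≤ w (Equivalence.to (above⇔reach w) 0≼j)))

wordHeap-semiPyramid : ∀ {n w} → NormalUpTo (suc n) w → w 0 ≤ 1 → SemiPyramid (wordHeap {suc n} w)
wordHeap-semiPyramid {w = w} normal w₀≤1 =
  zero , top-maximal w ,
  (λ j max-j → sym (max-j zero (Equivalence.from (above⇔reach w) (reach-from-top j (Fin.<-wellFounded j))))) ,
  Equivalence.from leftAbs≡1⇔ w₀≤1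
  where
  reach-from-top : ∀ q → Acc Fin._<_ q → Reach w zero q
  reach-from-top zero      _          = here
  reach-from-top q@(suc _) (acc below) with overlap-before-fin normal {zero} {q} (s≤s z≤n) (≤-trans w₀≤1 (s≤s z≤n))
  ... | k , _ , k<q , o = step (reach-from-top k (below k<q)) k<q o

semiPyramid⇒top≤1 : ∀ {n w} → SemiPyramid (wordHeap {suc n} w) → w 0 ≤ 1
semiPyramid⇒top≤1 {w = w} (m , _ , unique , left) with unique zero (top-maximal w)
... | refl = Equivalence.to leftAbs≡1⇔ left

fixed-below⇒≥ : ∀ {n} {f : Fin n → Fin n} → Injective _≡_ _≡_ f → ∀ {p : Fin n} → (∀ q → q Fin.< p → f q ≡ q) →
                ∀ {i} → p Fin.≤ i → p Fin.≤ f i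
fixed-below⇒≥ {f = f} f-injective {p} fixed {i} p≤i with f i Fin.<? p
... | no  fi≮p = ≮⇒≥ fi≮p
... | yes fi<p = ⊥-elim (≤⇒≯ p≤i (subst (Fin._< p) (f-injective (fixed (f i) fi<p)) fi<p))

fixed-below-inverse : ∀ {n} (π : Permutation′ n) {p : Fin n} → (∀ q → q Fin.< p → π ⟨$⟩ʳ q ≡ q) →
                      ∀ q → q Fin.< p → π ⟨$⟩ˡ q ≡ q
fixed-below-inverse π fixed q q<p = trans (cong (π ⟨$⟩ˡ_) (sym (fixed q q<p))) (inverseˡ π)

-- If p is the first position that π moves, say to x, no piece of w₂ strictly between p and x overlaps
-- x: its preimage would lie above p in the first heap without coming before p.  By normality,
-- w₂ x < w₂ p.
module _ {n} {w₁ w₂ : ℕ → ℕ} (normal₂ : NormalUpTo n w₂) (iso : Iso (wordHeap {n} w₁) (wordHeap w₂)) where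

  private
    π : Permutation′ n
    π = proj₁ iso

  moved⇒letter< : ∀ {p} → (∀ q → q Fin.< p → π ⟨$⟩ʳ q ≡ q) → π ⟨$⟩ʳ p ≢ p → w₁ (toℕ p) < w₂ (toℕ p)
  moved⇒letter< {p} fixed moved = subst (_< w₂ (toℕ p)) (pieceOf-injective (proj₁ (proj₂ iso) p)) moved-up
    where
    x : Fin n
    x = π ⟨$⟩ʳ p
    p<x : p Fin.< x
    p<x = ≤∧≢⇒< (fixed-below⇒≥ (Injection.injective (↔⇒↣ π)) fixed (≤-refl {toℕ p})) (moved ∘ sym ∘ Fin.toℕ-injective)
    moved-up : w₂ (toℕ x) < w₂ (toℕ p)
    moved-up with w₂ (toℕ x) <? w₂ (toℕ p)
    ... | yes lt = lt
    ... | no  ≮  with overlap-before-fin normal₂ p<x (≤-trans (≮⇒≥ ≮) (n≤1+n _))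
    ...   | k , p≤k , k<x , k∼x = ⊥-elim (Fin.<-irrefl k≡x k<x)
      where
      pulled-back : Reach w₁ (π ⟨$⟩ˡ k) p
      pulled-back =
        Equivalence.to (above⇔reach w₁)
          (Equivalence.to (iso-≼⇔ {H = wordHeap w₁} {wordHeap w₂} iso {p} {π ⟨$⟩ˡ k})
            (subst (_≼_ (wordHeap w₂) x) (sym (inverseʳ π)) (Equivalence.from (above⇔reach w₂) (step here k<x k∼x))))
      k≡x : k ≡ x
      k≡x = trans (sym (inverseʳ π))
                  (cong (π ⟨$⟩ʳ_) (Fin.≤-antisym (reach-≤ w₁ pulled-back)
                                                 (fixed-below⇒≥ (Injection.injective (↔⇒↣ (Perm.flip π)))
                                                                (fixed-below-inverse π fixed) p≤k)))

normal-iso⇒fixes : ∀ {n w₁ w₂} → NormalUpTo n w₁ → NormalUpTo n w₂ →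
                   ((π , _) : Iso (wordHeap {n} w₁) (wordHeap w₂)) → ∀ p → π ⟨$⟩ʳ p ≡ p
normal-iso⇒fixes {w₁ = w₁} {w₂} normal₁ normal₂ iso@(π , _) p = go p (Fin.<-wellFounded p)
  where
  go : ∀ p → Acc Fin._<_ p → π ⟨$⟩ʳ p ≡ p
  go p (acc below) with π ⟨$⟩ʳ p Fin.≟ p
  ... | yes fixed = fixed
  ... | no  moved = ⊥-elim (<-asym (moved⇒letter< normal₂ iso fixed moved)
                                    (moved⇒letter< normal₁ (iso-sym {H = wordHeap w₁} {wordHeap w₂} iso)
                                                   (fixed-below-inverse π fixed) π⁻¹-moved))
    where
    fixed : ∀ q → q Fin.< p → π ⟨$⟩ʳ q ≡ q
    fixed q q<p = go q (below q<p)
    π⁻¹-moved : π ⟨$⟩ˡ p ≢ p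
    π⁻¹-moved eq = moved (trans (cong (π ⟨$⟩ʳ_) (sym eq)) (inverseʳ π))

normal-iso⇒≗ : ∀ {n w₁ w₂} → NormalUpTo n w₁ → NormalUpTo n w₂ → Iso (wordHeap {n} w₁) (wordHeap w₂) →
               ∀ (p : Fin n) → w₁ (toℕ p) ≡ w₂ (toℕ p)
normal-iso⇒≗ {w₂ = w₂} normal₁ normal₂ iso@(_ , labels , _) p =
  sym (pieceOf-injective (trans (cong (pieceOf ∘ w₂ ∘ toℕ) (sym (normal-iso⇒fixes normal₁ normal₂ iso p))) (labels p)))

-- The normal form of a heap

minimal : ∀ {n ℓ} {_⊏_ : Rel (Fin n) ℓ} → WellFounded _⊏_ → Decidable _⊏_ →
          {P : Fin n → Set} → (∀ x → Dec (P x)) → ∀ {x} → P x → ∃ λ m → P m × ∀ y → P y → ¬ y ⊏ m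
minimal {_⊏_ = _⊏_} wf _⊏?_ {P} P? {x} px = go x (wf x) px
  where
  go : ∀ x → Acc _⊏_ x → P x → ∃ λ m → P m × ∀ y → P y → ¬ y ⊏ m
  go x (acc below) px with Fin.any? (λ y → P? y ×-dec (y ⊏? x))
  ... | yes (y , py , y⊏x) = go y (below y⊏x) py
  ... | no  none           = x , px , λ y py y⊏x → none (y , py , y⊏x)

injective⇒surjective : ∀ {n} {f : Fin n → Fin n} → Injective _≡_ _≡_ f → ∀ y → ∃ λ x → f x ≡ y
injective⇒surjective {suc n} {f} f-injective y with Fin.any? (λ x → f x Fin.≟ y)
... | yes hit  = hit
... | no  miss = ⊥-elim (<-irrefl refl (Fin.injective⇒≤ g-injective))
  where
  g : Fin (suc n) → Fin n
  g x = Fin.punchOut {i = y} λ eq → miss (x , sym eq)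
  g-injective : Injective _≡_ _≡_ g
  g-injective {x} {x′} eq = f-injective (Fin.punchOut-injective (λ e → miss (x , sym e)) (λ e → miss (x′ , sym e)) eq)

tabulate-linked : ∀ {n} {R : A → A → Set} (f : Fin n → A) →
                  (∀ (p q : Fin n) → toℕ q ≡ suc (toℕ p) → R (f p) (f q)) → Linked R (tabulate f)
tabulate-linked {n = zero}        f _    = []
tabulate-linked {n = suc zero}    f _    = [-]
tabulate-linked {n = suc (suc n)} f next =
  next zero (suc zero) refl ∷ tabulate-linked (f ∘ suc) λ p q eq → next (suc p) (suc q) (cong suc eq)

letterAt-tabulate : ∀ {n} (f : Fin n → ℕ) (p : Fin n) → letterAt (tabulate f) (toℕ p) ≡ f p
letterAt-tabulate f zero    = refl
letterAt-tabulate f (suc p) = letterAt-tabulate (f ∘ suc) p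

T-⇔⇒≡ : ∀ {a b} → (T a ⇔ T b) → a ≡ b
T-⇔⇒≡ T⇔T = ⇔→≡ (⇔.trans (⇔.sym T-≡) (⇔.trans T⇔T T-≡))

module _ {n} (H : Heap n) where

  _≼?_ : Decidable (_≼_ H)
  i ≼? j = T? (leq H i j)

  _≺?_ : Decidable (_≺_ H)
  i ≺? j = (i ≼? j) ×-dec ¬? (i Fin.≟ j)

  ≺-isStrictPartialOrder : IsStrictPartialOrder _≡_ (_≺_ H)
  ≺-isStrictPartialOrder = record
    { isEquivalence = isEquivalence
    ; irrefl        = λ { refl (_ , i≢i) → i≢i refl }
    ; trans         = λ {i} {j} {k} (i≼j , i≢j) (j≼k , _) →
                        ≼-trans H i j k i≼j j≼k , λ { refl → i≢j (≼-antisym H i j i≼j j≼k) }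
    ; <-resp-≈      = (λ { refl i≺j → i≺j }) , (λ { refl i≺j → i≺j })
    }

-- The pieces are listed greedily from the top: placed p holds those at positions < p, and position p
-- receives a maximal unplaced piece with the largest letter.
module NormalForm {n} (H : Heap n) where

  letter : Fin n → ℕ
  letter = letterOf ∘ label H

  Unplaced : (Fin n → Bool) → Fin n → Set
  Unplaced S x = S x ≡ false

  unplaced? : ∀ S x → Dec (Unplaced S x)
  unplaced? S x = S x Bool.≟ false

  Top : (Fin n → Bool) → Fin n → Set
  Top S x = Unplaced S x × (∀ y → Unplaced S y → ¬ _≺_ H x y)

  top? : ∀ S x → Dec (Top S x)
  top? S x = unplaced? S x ×-dec Fin.all? (λ y → unplaced? S y →-dec ¬? (_≺?_ H x y))

  BestTop : (Fin n → Bool) → Fin n → Set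
  BestTop S x = Top S x × (∀ y → Top S y → letter y ≤ letter x)

  top-or-below : ∀ S {y} → Unplaced S y → Top S y ⊎ ∃ λ z → Unplaced S z × _≺_ H y z
  top-or-below S {y} uy with Fin.any? (λ z → unplaced? S z ×-dec _≺?_ H y z)
  ... | yes found = inj₂ found
  ... | no  none  = inj₁ (uy , λ z uz y≺z → none (z , uz , y≺z))

  bestTop-exists : ∀ S {x} → Unplaced S x → ∃ (BestTop S)
  bestTop-exists S ux =
    let (t , top-t) = minimal (spo-noetherian (≺-isStrictPartialOrder H)) (flip (_≺?_ H)) (unplaced? S) ux
        (b , top-b , best) = minimal letter-wf (λ x y → letter y <? letter x) (top? S) {t} top-t
    in b , top-b , λ y top-y → ≮⇒≥ (best y top-y)
    where
    letter-wf : WellFounded (λ x y → letter y < letter x)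
    letter-wf = spo-wellFounded (On.isStrictPartialOrder letter (Flip.isStrictPartialOrder <-isStrictPartialOrder))

  choose : (S : Fin n → Bool) → Maybe (∃ (BestTop S))
  choose S with Fin.any? (unplaced? S)
  ... | yes (x , ux) = just (bestTop-exists S ux)
  ... | no  _        = nothing

  choose-nothing : ∀ S → choose S ≡ nothing → ∀ x → S x ≡ true
  choose-nothing S eq x with Fin.any? (unplaced? S)
  choose-nothing S () x | yes _
  choose-nothing S eq x | no  none with S x in Sx
  ... | true  = refl
  ... | false = ⊥-elim (none (x , Sx))

  isChosen : Maybe (Fin n) → Fin n → Bool
  isChosen nothing  _ = false
  isChosen (just y) x = isYes (y Fin.≟ x)

  placed : ℕ → Fin n → Bool
  chosen : ℕ → Maybe (Fin n)

  placed zero    x = false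
  placed (suc p) x = placed p x ∨ isChosen (chosen p) x

  chosen p = Maybe.map proj₁ (choose (placed p))

  chosen-bestTop : ∀ p {x} → chosen p ≡ just x → BestTop (placed p) x
  chosen-bestTop p eq with choose (placed p)
  chosen-bestTop p refl | just (_ , best) = best

  placed-suc⁺ : ∀ p {x} → placed p x ≡ true → placed (suc p) x ≡ true
  placed-suc⁺ p e rewrite e = refl

  placed-mono : ∀ {p q x} → p ≤ q → placed p x ≡ true → placed q x ≡ true
  placed-mono p≤q e with m≤n⇒m<n∨m≡n p≤q
  ... | inj₂ refl       = e
  ... | inj₁ (s≤s {n = q′} p≤q′) = placed-suc⁺ q′ (placed-mono p≤q′ e)

  chosen⇒placed : ∀ p {q x} → chosen p ≡ just x → p < q → placed q x ≡ true
  chosen⇒placed p {x = x} c p<q = placed-mono p<q now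
    where
    now : placed (suc p) x ≡ true
    now rewrite c with x Fin.≟ x
    ... | yes _   = ∨-zeroʳ (placed p x)
    ... | no  x≢x = ⊥-elim (x≢x refl)

  placed⇒chosen : ∀ p {x} → placed p x ≡ true → ∃ λ q → q < p × chosen q ≡ just x
  placed⇒chosen (suc p) {x} e with placed p x in e′ | chosen p in c
  ... | true  | _      = let (q , q<p , cq) = placed⇒chosen p e′ in q , m≤n⇒m≤1+n q<p , cq
  ... | false | just y with y Fin.≟ x
  ...   | yes refl = p , ≤-refl , c

  unplaced-suc⁻ : ∀ p {x} → placed (suc p) x ≡ false → placed p x ≡ false
  unplaced-suc⁻ p {x} e with placed p x
  ... | false = refl

  unplaced-suc⁺ : ∀ p {x y} → placed p x ≡ false → chosen p ≡ just y → y ≢ x → placed (suc p) x ≡ false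
  unplaced-suc⁺ p {x} {y} e c y≢x rewrite e | c with y Fin.≟ x
  ... | yes y≡x = ⊥-elim (y≢x y≡x)
  ... | no  _   = refl

  chosen-defined : ∀ p → p < n → ∃ λ x → chosen p ≡ just x
  chosen-defined p p<n with choose (placed p) in eq
  ... | just (x , _) = x , refl
  ... | nothing      = ⊥-elim (≤⇒≯ (Fin.injective⇒≤ pickedAt-injective) p<n)
    where
    all-placed : ∀ x → placed p x ≡ true
    all-placed = choose-nothing (placed p) eq
    earlier : ∀ x → ∃ λ q → q < p × chosen q ≡ just x
    earlier x = placed⇒chosen p (all-placed x)
    pickedAt : Fin n → Fin p
    pickedAt x = fromℕ< (proj₁ (proj₂ (earlier x)))
    pickedAt-injective : Injective _≡_ _≡_ pickedAt
    pickedAt-injective {x} {y} eq′ =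
      just-injective (trans (sym (proj₂ (proj₂ (earlier x))))
                            (trans (cong chosen (Fin.fromℕ<-injective _ _ _ _ eq′)) (proj₂ (proj₂ (earlier y)))))

  ρ : Fin n → Fin n
  ρ p = proj₁ (chosen-defined (toℕ p) (Fin.toℕ<n p))

  ρ-chosen : ∀ p → chosen (toℕ p) ≡ just (ρ p)
  ρ-chosen p = proj₂ (chosen-defined (toℕ p) (Fin.toℕ<n p))

  ρ-bestTop : ∀ p → BestTop (placed (toℕ p)) (ρ p)
  ρ-bestTop p = chosen-bestTop (toℕ p) (ρ-chosen p)

  placed-and-unplaced : ∀ p {x} → placed p x ≡ true → placed p x ≡ false → ⊥
  placed-and-unplaced p t f with () ← trans (sym t) f

  ρ-unplaced : ∀ q p → q ≤ toℕ p → placed q (ρ p) ≡ false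
  ρ-unplaced q p q≤p with placed q (ρ p) in e
  ... | false = refl
  ... | true  = ⊥-elim (placed-and-unplaced (toℕ p) (placed-mono q≤p e) (proj₁ (proj₁ (ρ-bestTop p))))

  ρ-distinct : ∀ {p q} → p Fin.< q → ρ p ≢ ρ q
  ρ-distinct {p} {q} p<q eq =
    placed-and-unplaced (toℕ q) (chosen⇒placed (toℕ p) (trans (ρ-chosen p) (cong just eq)) p<q) (proj₁ (proj₁ (ρ-bestTop q)))

  ρ-injective : Injective _≡_ _≡_ ρ
  ρ-injective {p} {q} eq with Fin.<-cmp p q
  ... | tri≈ _ p≡q _ = p≡q
  ... | tri< p<q _ _ = ⊥-elim (ρ-distinct p<q eq)
  ... | tri> _ _ q<p = ⊥-elim (ρ-distinct q<p (sym eq))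

  placed-upward : ∀ p {x y} → placed p x ≡ true → _≺_ H x y → placed p y ≡ true
  placed-upward p {y = y} px x≺y with placed⇒chosen p px
  ... | q , q<p , cq with placed q y in qy
  ...   | true  = placed-mono (<⇒≤ q<p) qy
  ...   | false = ⊥-elim (proj₂ (proj₁ (chosen-bestTop q cq)) y qy x≺y)

  ρ-linear : ∀ {p q} → p Fin.< q → ¬ _≺_ H (ρ p) (ρ q)
  ρ-linear {p} {q} p<q = proj₂ (proj₁ (ρ-bestTop p)) (ρ q) (ρ-unplaced (toℕ p) q (<⇒≤ p<q))

  -- If ρ q was not yet maximal when ρ p was chosen, then ρ p covers it, so the two are concurrent.
  ρ-normal : ∀ p q → toℕ q ≡ suc (toℕ p) → CanFollow (letter (ρ p)) (letter (ρ q))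
  ρ-normal p q q≡1+p =
    [ lower-top , below-ρp ]′ (top-or-below (placed (toℕ p)) (unplaced-suc⁻ (toℕ p) (proj₁ ρq-top)))
    where
    ρq-top : Top (placed (suc (toℕ p))) (ρ q)
    ρq-top = subst (λ r → Top (placed r) (ρ q)) q≡1+p (proj₁ (ρ-bestTop q))
    still-unplaced : ∀ {z} → placed (toℕ p) z ≡ false → z ≢ ρ p → placed (suc (toℕ p)) z ≡ false
    still-unplaced uz z≢ρp = unplaced-suc⁺ (toℕ p) uz (ρ-chosen p) (z≢ρp ∘ sym)
    lower-top : Top (placed (toℕ p)) (ρ q) → CanFollow (letter (ρ p)) (letter (ρ q))
    lower-top top = ≤-trans (proj₂ (ρ-bestTop p) (ρ q) top) (n≤1+n _)
    nothing-between : ∀ k → ¬ (_≺_ H (ρ q) k × _≺_ H k (ρ p))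
    nothing-between k (ρq≺k , k≺ρp) with placed (toℕ p) k in pk
    ... | true  = placed-and-unplaced (toℕ p) (placed-upward (toℕ p) pk k≺ρp) (proj₁ (proj₁ (ρ-bestTop p)))
    ... | false = proj₂ ρq-top k (still-unplaced pk (proj₂ k≺ρp)) ρq≺k
    below-ρp : (∃ λ z → Unplaced (placed (toℕ p)) z × _≺_ H (ρ q) z) → CanFollow (letter (ρ p)) (letter (ρ q))
    below-ρp (z , uz , ρq≺z) with z Fin.≟ ρ p
    ... | no  z≢ρp = ⊥-elim (proj₂ ρq-top z (still-unplaced uz z≢ρp) ρq≺z)
    ... | yes refl = proj₁ (Equivalence.to (concurrent⇔ {label H (ρ q)} {label H (ρ p)})
                                           (cover⇒concurrent H (ρ q) (ρ p) (ρq≺z , nothing-between)))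

  σ : Fin n → Fin n
  σ x = proj₁ (injective⇒surjective ρ-injective x)

  ρσ : ∀ x → ρ (σ x) ≡ x
  ρσ x = proj₂ (injective⇒surjective ρ-injective x)

  σρ : ∀ p → σ (ρ p) ≡ p
  σρ p = ρ-injective (ρσ (ρ p))

  word : Word
  word = tabulate (letter ∘ ρ)

  label-ρ : ∀ p → pieceOf (letterAt word (toℕ p)) ≡ label H (ρ p)
  label-ρ p = trans (cong pieceOf (letterAt-tabulate (letter ∘ ρ) p)) (pieceOf-letterOf (label H (ρ p)))

  label-σ : ∀ x → pieceOf (letterAt word (toℕ (σ x))) ≡ label H x
  label-σ x = trans (label-ρ (σ x)) (cong (label H) (ρσ x))

  σ-< : ∀ {u v} → _≺_ H u v → σ v Fin.< σ u
  σ-< {u} {v} u≺v with Fin.<-cmp (σ v) (σ u)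
  ... | tri< σv<σu _ _ = σv<σu
  ... | tri≈ _ σv≡σu _ = ⊥-elim (proj₂ u≺v (trans (sym (ρσ u)) (trans (cong ρ (sym σv≡σu)) (ρσ v))))
  ... | tri> _ _ σu<σv = ⊥-elim (ρ-linear σu<σv (subst₂ (_≺_ H) (sym (ρσ u)) (sym (ρσ v)) u≺v))

  reach⇒≽ : ∀ {p q} → Reach (letterAt word) p q → _≼_ H (ρ q) (ρ p)
  reach⇒≽ here = ≼-refl H _
  reach⇒≽ (step {k} {q} r k<q o)
    with concurrent⇒comparable H (ρ k) (ρ q) (subst₂ Concurrent (label-ρ k) (label-ρ q) o)
  ... | inj₂ ρq≼ρk = ≼-trans H _ _ _ ρq≼ρk (reach⇒≽ r)
  ... | inj₁ ρk≼ρq = ⊥-elim (ρ-linear k<q (ρk≼ρq , ρ-distinct k<q))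

  ≼⇒reach : ∀ {u v} → _≼_ H u v → Reach (letterAt word) (σ v) (σ u)
  ≼⇒reach {u} {v} u≼v = go u (spo-noetherian (≺-isStrictPartialOrder H) u) u≼v
    where
    go : ∀ u → Acc (flip (_≺_ H)) u → _≼_ H u v → Reach (letterAt word) (σ v) (σ u)
    go u (acc higher) u≼v with u Fin.≟ v
    ... | yes refl = here
    ... | no  u≢v
      with minimal (spo-wellFounded (≺-isStrictPartialOrder H)) (_≺?_ H)
                   (λ k → _≺?_ H u k ×-dec _≼?_ H k v) ((u≼v , u≢v) , ≼-refl H v)
    ... | k , (u≺k , k≼v) , k-minimal = step (go k (higher u≺k) k≼v) (σ-< u≺k) k∼u
      where
      u⋖k : _⋖_ H u k
      u⋖k = u≺k , λ m (u≺m , m≺k) → k-minimal m (u≺m , ≼-trans H m k v (proj₁ m≺k) k≼v) m≺k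
      k∼u : Overlap (letterAt word) (σ k) (σ u)
      k∼u = subst₂ Concurrent (sym (label-σ k)) (sym (label-σ u))
                       (concurrent-sym {label H u} {label H k} (cover⇒concurrent H u k u⋖k))

  iso : Iso H (wordHeap (letterAt word))
  iso = Perm.permutation σ ρ σρ ρσ , label-σ ,
        λ i j → T-⇔⇒≡ (⇔.trans (above⇔reach (letterAt word))
                                     (mk⇔ (subst₂ (_≼_ H) (ρσ i) (ρσ j) ∘ reach⇒≽) ≼⇒reach))

normalForm : ∀ {n} (H : Heap n) → ∃ λ r → length r ≡ n × NormalWord r × Iso H (wordHeap (letterAt r))
normalForm H = word , length-tabulate (letter ∘ ρ) , tabulate-linked (letter ∘ ρ) ρ-normal , iso
  where open NormalForm H

-- Counting semi-pyramids

sumFin-letterAt : ∀ (g : ℕ → ℕ) r → sumFin (length r) (g ∘ letterAt r ∘ toℕ) ≡ sum (map g r)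
sumFin-letterAt g []      = refl
sumFin-letterAt g (t ∷ r) = cong (g t +_) (sumFin-letterAt g r)

wordHeap-yWeight : ∀ {n} r → length r ≡ n → yWeight (wordHeap {n} (letterAt r)) ≡ ySum r
wordHeap-yWeight r refl = sumFin-letterAt letterSize r

wordHeap-pWeight : ∀ {n} r → length r ≡ n → pWeight (wordHeap {n} (letterAt r)) ≡ pSum r
wordHeap-pWeight r refl = sumFin-letterAt letterLeft r

letterAt-ext : ∀ {n} r r′ → length r ≡ n → length r′ ≡ n →
               (∀ (p : Fin n) → letterAt r (toℕ p) ≡ letterAt r′ (toℕ p)) → r ≡ r′
letterAt-ext []      []        _    _  _    = refl
letterAt-ext []      (_ ∷ _)   refl ()
letterAt-ext (_ ∷ _) []        refl ()
letterAt-ext (t ∷ r) (t′ ∷ r′) refl eq same =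
  cong₂ _∷_ (same zero) (letterAt-ext r r′ refl (suc-injective eq) (same ∘ suc))

-- NormalWord (0 ∷ r) says that r is normal and starts with a letter at most 1.
PyramidCode : ℕ → ℕ → ℕ → Word → Set
PyramidCode a b c r = NormalWord (0 ∷ r) × HasWeight a b c r

code-normal : ∀ {n r} → NormalWord (0 ∷ r) → length r ≡ n → NormalUpTo n (letterAt r)
code-normal normal refl = normal-letterAt (Linked.tail normal)

code-admissible : ∀ {n r} → NormalWord (0 ∷ r) → length r ≡ n → Admissible (wordHeap {n} (letterAt r))
code-admissible {zero}  _               _ = inj₁ refl
code-admissible {suc _} (t≤1 ∷ normal) l = inj₂ (wordHeap-semiPyramid (code-normal (t≤1 ∷ normal) l) t≤1)

admissible⇒code : ∀ {n r} {H : Heap n} → Admissible H → length r ≡ n → NormalWord r →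
                  Iso H (wordHeap (letterAt r)) → NormalWord (0 ∷ r)
admissible⇒code {r = []}    _         _    _      _   = [-]
admissible⇒code {r = _ ∷ _} (inj₁ ()) refl _      _
admissible⇒code {r = r@(_ ∷ _)} {H} (inj₂ pyramid) refl normal iso =
  semiPyramid⇒top≤1 {w = letterAt r} (iso-semiPyramid {H = H} {wordHeap (letterAt r)} iso pyramid) ∷ normal

isoClassCount : ∀ {a b c N} → Enumeration (Fin N) (PyramidCode a b c) → IsoClassCount a b c N
isoClassCount {a} {b} {c} E = pyramid ∘ element E , (λ i → describe (sound E i)) , distinct , exhaustive
  where
  pyramid : Word → Heap a
  pyramid r = wordHeap (letterAt r)

  describe : ∀ {r} → PyramidCode a b c r → Admissible (pyramid r) × yWeight (pyramid r) ≡ b × pWeight (pyramid r) ≡ c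
  describe {r} (normal , l , y , p) =
    code-admissible normal l , trans (wordHeap-yWeight r l) y , trans (wordHeap-pWeight r l) p

  distinct : ∀ i j → Iso (pyramid (element E i)) (pyramid (element E j)) → i ≡ j
  distinct i j iso with sound E i | sound E j
  ... | (nᵢ , lᵢ , _) | (nⱼ , lⱼ , _) =
    injective E (letterAt-ext _ _ lᵢ lⱼ (normal-iso⇒≗ {w₁ = letterAt (element E i)} {letterAt (element E j)}
                                                      (code-normal nᵢ lᵢ) (code-normal nⱼ lⱼ) iso))

  exhaustive : ∀ H → Admissible H → yWeight H ≡ b → pWeight H ≡ c → ∃ λ i → Iso H (pyramid (element E i))
  exhaustive H admissible yb pc with normalForm H
  ... | r , l , normal , iso
    with complete E (admissible⇒code {H = H} admissible l normal iso , l ,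
                     trans (sym (wordHeap-yWeight r l)) (trans (iso-sumFin {H = H} {pyramid r} iso size) yb) ,
                     trans (sym (wordHeap-pWeight r l)) (trans (iso-sumFin {H = H} {pyramid r} iso leftAbs) pc))
  ... | i , refl = i , iso

-- Every word counted by F starts with the letter 0 of a_0 = pxy, which G' = (F - 1)/(pxy) strips off.
pyramidCodes : ∀ a b c → Enumeration (Fin (F (suc a) (suc b) (suc c))) (PyramidCode a b c)
pyramidCodes a b c =
  enum-⇔ (mk⇔ to from) (enum-∷⁻ starts-with-0 (enumerates-cfTrunc (suc (suc a)) 0 (suc a) (suc b) (suc c)))
  where
  to : ∀ {r} → CFWord (suc (suc a)) 0 (0 ∷ r) × HasWeight (suc a) (suc b) (suc c) (0 ∷ r) → PyramidCode a b c r
  to (cf , l , y , p) = Rooted.normal (cfWord⇒rooted (suc (suc a)) cf) , suc-injective l , suc-injective y , suc-injective p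
  from : ∀ {r} → PyramidCode a b c r → CFWord (suc (suc a)) 0 (0 ∷ r) × HasWeight (suc a) (suc b) (suc c) (0 ∷ r)
  from {r} (normal , l , y , p) =
    rooted⇒cfWord (0 ∷ r) (s≤s (s≤s (≤-reflexive l)))
                  (record { above = All.universal (λ _ → z≤n) (0 ∷ r) ; starts = refl ; normal = normal }) ,
    cong suc l , cong suc y , cong suc p
  starts-with-0 : ∀ {x} → CFWord (suc (suc a)) 0 x × HasWeight (suc a) (suc b) (suc c) x → ∃ λ r → x ≡ 0 ∷ r
  starts-with-0 {[]}    (_ , () , _)
  starts-with-0 {t ∷ r} (cf , _) with Rooted.starts (cfWord⇒rooted (suc (suc a)) {0} cf)
  ... | refl = r , refl

weight-zero : ∀ {a b c x} → HasWeight a b c x → a ≡ 0 ⊎ b ≡ 0 ⊎ c ≡ 0 → a ≡ 0 × b ≡ 0 × c ≡ 0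
weight-zero {x = []}        (refl , refl , refl) _ = refl , refl , refl
weight-zero {x = zero ∷ _}  (refl , refl , refl) (inj₂ (inj₁ ()))
weight-zero {x = zero ∷ _}  (refl , refl , refl) (inj₂ (inj₂ ()))
weight-zero {x = suc _ ∷ _} (refl , refl , refl) (inj₂ (inj₁ ()))
weight-zero {x = suc _ ∷ _} (refl , refl , refl) (inj₂ (inj₂ ()))

F-vanishes : ∀ a b c → (a ≡ 0 ⊎ b ≡ 0 ⊎ c ≡ 0) → ¬ (a ≡ 0 × b ≡ 0 × c ≡ 0) → F a b c ≡ 0
F-vanishes a b c some-zero not-all =
  enum-empty (enumerates-cfTrunc (suc a) 0 a b c) λ {x} (_ , w) → not-all (weight-zero {x = x} w some-zero)

proposition7p1 :
    -- F - 1 is divisible by p x y (so G' = (F - 1) divided by pxy is a power series) ...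
    (F 0 0 0 ≡ 1) ×
    (∀ a b c → (a ≡ 0 ⊎ b ≡ 0 ⊎ c ≡ 0) → ¬ (a ≡ 0 × b ≡ 0 × c ≡ 0) → F a b c ≡ 0) ×
    -- ... and [x^a y^b p^c] G = [x^a y^b p^c] G' = [x^(a+1) y^(b+1) p^(c+1)] F
    (∀ a b c → IsoClassCount a b c (F (suc a) (suc b) (suc c)))
proposition7p1 = refl , F-vanishes , λ a b c → isoClassCount (pyramidCodes a b c)
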